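{- Let $\underline{D}$ be a double Boolean algebra of type $l$ for some $l\in\{I,II,IV,V\}$. Then $\underline{D}$ is simple if and only if $|D|\le 2$.
   Context: A double Boolean algebra (dBa) is an algebra $\underline{D}=(D;\sqcap,\sqcup,\neg,\lrcorner,\bot,\top)$ of type $(2,2,1,1,0,0)$ satisfying, for all $x,y,z$, where $x\vee y:=\neg(\neg x\sqcap\neg y)$ and $x\wedge y:=\lrcorner(\lrcorner x\sqcup\lrcorner y)$: $(x\sqcap x)\sqcap y=x\sqcap y$; $(x\sqcup x)\sqcup y=x\sqcup y$; $\sqcap$ and $\sqcup$ are commutative and associative; $x\sqcap(x\sqcup y)=x\sqcap x$; $x\sqcup(x\sqcap y)=x\sqcup x$; $x\sqcap(x\vee y)=x\sqcap x$; $x\sqcup(x\wedge y)=x\sqcup x$; $x\sqcap(y\vee z)=(x\sqcap y)\vee(x\sqcap z)$; $x\sqcup(y\wedge z)=(x\sqcup y)\wedge(x\sqcup z)$; $\neg\neg(x\sqcap y)=x\sqcap y$; $\lrcorner\lrcorner(x\sqcup y)=x\sqcup y$; $\neg(x\sqcap x)=\neg x$; $\lrcorner(x\sqcup x)=\lrcorner x$; $x\sqcap\neg x=\bot$; $x\sqcup\lrcorner x=\top$; $\neg\bot=\top\sqcap\top$; $\lrcorner\top=\bot\sqcup\bot$; $\neg\top=\bot$; $\lrcorner\bot=\top$; $(x\sqcap x)\sqcup(x\sqcap x)=(x\sqcup x)\sqcap(x\sqcup x)$. $D_\sqcap=\{x: x\sqcap x=x\}$, $D_\sqcup=\{x: x\sqcup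 x=x\}$, $D_p=D_\sqcap\cup D_\sqcup$ (universe of a subalgebra $\underline{D}_p$). Types: type $I$ if $D_\sqcup=\{\top\}$; type $II$ if $D_\sqcap=\{\bot\}$; type $IV$ if $\bot=\top$ or $\bot\sqcup\bot\neq\bot$ or $\top\sqcap\top\neq\top$; type $V$ if the subalgebra $\underline{D}_p$ is a Boolean algebra (with $\sqcap,\sqcup$ as meet and join, $\bot,\top$ as bounds, and $\neg,\lrcorner$ both as complementation). Simple means the only congruences (equivalence relations compatible with all operations) are $\Delta_D$ and $D\times D$. -}

module Defs where

open import Data.Product using (Σ; _×_; _,_; proj₁; ∃)
open import Data.Sum using (_⊎_)
open import Relation.Nullary using (¬_)
open import Relation.Binary.PropositionalEquality using (_≡_)
open import Relation.Binary.Core using (Rel)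
open import Level using (0ℓ)
open import Relation.Binary.Structures using (IsEquivalence)
open import Algebra.Lattice.Structures using (IsBooleanAlgebra)

record DBA : Set₁ where
  infixr 7 _⊓_
  infixr 6 _⊔_
  field
    D    : Set
    _⊓_  : D → D → D
    _⊔_  : D → D → D
    ¬'   : D → D
    ⌟    : D → D
    ⊥'   : D
    ⊤'   : D

  _∨_ : D → D → D
  x ∨ y = ¬' (¬' x ⊓ ¬' y)

  _∧_ : D → D → D
  x ∧ y = ⌟ (⌟ x ⊔ ⌟ y)

  field
    ⊓-idem-l   : ∀ x y → (x ⊓ x) ⊓ y ≡ x ⊓ y
    ⊔-idem-l   : ∀ x y → (x ⊔ x) ⊔ y ≡ x ⊔ y
    ⊓-comm     : ∀ x y → x ⊓ y ≡ y ⊓ x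
    ⊔-comm     : ∀ x y → x ⊔ y ≡ y ⊔ x
    ⊓-assoc    : ∀ x y z → x ⊓ (y ⊓ z) ≡ (x ⊓ y) ⊓ z
    ⊔-assoc    : ∀ x y z → x ⊔ (y ⊔ z) ≡ (x ⊔ y) ⊔ z
    ⊓-absorb-⊔ : ∀ x y → x ⊓ (x ⊔ y) ≡ x ⊓ x
    ⊔-absorb-⊓ : ∀ x y → x ⊔ (x ⊓ y) ≡ x ⊔ x
    ⊓-absorb-∨ : ∀ x y → x ⊓ (x ∨ y) ≡ x ⊓ x
    ⊔-absorb-∧ : ∀ x y → x ⊔ (x ∧ y) ≡ x ⊔ x
    ⊓-distrib-∨ : ∀ x y z → x ⊓ (y ∨ z) ≡ (x ⊓ y) ∨ (x ⊓ z)
    ⊔-distrib-∧ : ∀ x y z → x ⊔ (y ∧ z) ≡ (x ⊔ y) ∧ (x ⊔ z)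
    ¬¬-⊓       : ∀ x y → ¬' (¬' (x ⊓ y)) ≡ x ⊓ y
    ⌟⌟-⊔       : ∀ x y → ⌟ (⌟ (x ⊔ y)) ≡ x ⊔ y
    ¬-⊓-idem   : ∀ x → ¬' (x ⊓ x) ≡ ¬' x
    ⌟-⊔-idem   : ∀ x → ⌟ (x ⊔ x) ≡ ⌟ x
    ⊓-¬        : ∀ x → x ⊓ ¬' x ≡ ⊥'
    ⊔-⌟        : ∀ x → x ⊔ ⌟ x ≡ ⊤'
    ¬⊥         : ¬' ⊥' ≡ ⊤' ⊓ ⊤'
    ⌟⊤         : ⌟ ⊤' ≡ ⊥' ⊔ ⊥'
    ¬⊤         : ¬' ⊤' ≡ ⊥'
    ⌟⊥         : ⌟ ⊥' ≡ ⊤'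
    mixed      : ∀ x → (x ⊓ x) ⊔ (x ⊓ x) ≡ (x ⊔ x) ⊓ (x ⊔ x)

module _ (A : DBA) where
  open DBA A

  D⊓ : D → Set
  D⊓ x = x ⊓ x ≡ x

  D⊔ : D → Set
  D⊔ x = x ⊔ x ≡ x

  Dp : D → Set
  Dp x = D⊓ x ⊎ D⊔ x

  TypeI : Set
  TypeI = D⊔ ⊤' × (∀ x → D⊔ x → x ≡ ⊤')

  TypeII : Set
  TypeII = D⊓ ⊥' × (∀ x → D⊓ x → x ≡ ⊥')

  TypeIV : Set
  TypeIV = (⊥' ≡ ⊤') ⊎ (¬ (⊥' ⊔ ⊥' ≡ ⊥')) ⊎ (¬ (⊤' ⊓ ⊤' ≡ ⊤'))

  Dp-Carrier : Set
  Dp-Carrier = Σ D Dp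

  _≈p_ : Rel Dp-Carrier 0ℓ
  a ≈p b = proj₁ a ≡ proj₁ b

  record TypeV : Set where
    field
      ⊓-closed : ∀ x y → Dp x → Dp y → Dp (x ⊓ y)
      ⊔-closed : ∀ x y → Dp x → Dp y → Dp (x ⊔ y)
      ¬-closed : ∀ x → Dp x → Dp (¬' x)
      ⌟-closed : ∀ x → Dp x → Dp (⌟ x)
      ⊥-closed : Dp ⊥'
      ⊤-closed : Dp ⊤'

    _⊓p_ : Dp-Carrier → Dp-Carrier → Dp-Carrier
    (x , px) ⊓p (y , py) = x ⊓ y , ⊓-closed x y px py

    _⊔p_ : Dp-Carrier → Dp-Carrier → Dp-Carrier
    (x , px) ⊔p (y , py) = x ⊔ y , ⊔-closed x y px py

    ¬p : Dp-Carrier → Dp-Carrier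
    ¬p (x , px) = ¬' x , ¬-closed x px

    ⌟p : Dp-Carrier → Dp-Carrier
    ⌟p (x , px) = ⌟ x , ⌟-closed x px

    ⊥p : Dp-Carrier
    ⊥p = ⊥' , ⊥-closed

    ⊤p : Dp-Carrier
    ⊤p = ⊤' , ⊤-closed

    field
      boolean-¬ : IsBooleanAlgebra _≈p_ _⊔p_ _⊓p_ ¬p ⊤p ⊥p
      boolean-⌟ : IsBooleanAlgebra _≈p_ _⊔p_ _⊓p_ ⌟p ⊤p ⊥p

  OfTypeI-II-IV-V : Set
  OfTypeI-II-IV-V = TypeI ⊎ TypeII ⊎ TypeIV ⊎ TypeV

  record IsCongruence (θ : Rel D 0ℓ) : Set where
    field
      isEquivalence : IsEquivalence θ
      ⊓-cong : ∀ {x x' y y'} → θ x x' → θ y y' → θ (x ⊓ y) (x' ⊓ y')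
      ⊔-cong : ∀ {x x' y y'} → θ x x' → θ y y' → θ (x ⊔ y) (x' ⊔ y')
      ¬-cong : ∀ {x x'} → θ x x' → θ (¬' x) (¬' x')
      ⌟-cong : ∀ {x x'} → θ x x' → θ (⌟ x) (⌟ x')
      -- (nullary operations ⊥, ⊤ are trivially compatible by reflexivity)

  IsDiagonal : Rel D 0ℓ → Set
  IsDiagonal θ = ∀ x y → θ x y → x ≡ y

  IsAll : Rel D 0ℓ → Set
  IsAll θ = ∀ x y → θ x y

  Simple : Set₁
  Simple = ∀ (θ : Rel D 0ℓ) → IsCongruence θ → IsDiagonal θ ⊎ IsAll θ

  AtMostTwo : Set
  AtMostTwo = Σ D λ a → Σ D λ b → ∀ x → x ≡ a ⊎ x ≡ b

{-# OPTIONS --safe #-}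
-- Two congruences do the work. The kernel of x ↦ (x ⊓ x, x ⊔ x) is always a congruence.
-- If it is everything, all operations are constant, so every equivalence relation is a
-- congruence and simplicity forces |D| ≤ 2. If it is the diagonal and D⊔ ⊆ D⊓, then D is
-- ⊓-idempotent, and the relations θ_a (x θ_a y iff a ⊓ x = a ⊓ y), once they are congruences,
-- force every a to be ⊤ (θ_a diagonal) or ⊥ (θ_a total). For types I and V both conditions
-- hold; type II is dual to type I, and type IV reduces to types I and II.
module Submission where

open import Defs
open import Level using (0ℓ)
open import Function.Bundles using (_⇔_; mk⇔)
open import Axiom.ExcludedMiddle using (ExcludedMiddle)
open import Data.Product using (Σ; _×_; _,_; proj₁; proj₂)
open import Data.Sum using (_⊎_; inj₁; inj₂)
open import Data.Empty using (⊥-elim)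
open import Relation.Nullary using (¬_; yes; no)
open import Relation.Binary.PropositionalEquality
  using (_≡_; refl; sym; trans; cong; cong₂; module ≡-Reasoning)
open import Relation.Binary.Core using (Rel)
open import Relation.Binary.Structures using (IsEquivalence)
open import Algebra.Lattice.Bundles using (BooleanAlgebra)
open import Algebra.Lattice.Structures using (IsBooleanAlgebra)
import Algebra.Lattice.Properties.BooleanAlgebra as BooleanAlgebraProperties
import Relation.Binary.Reasoning.Setoid as SetoidReasoning

dual : DBA → DBA
dual A = record
  { D = D ; _⊓_ = _⊔_ ; _⊔_ = _⊓_ ; ¬' = ⌟ ; ⌟ = ¬' ; ⊥' = ⊤' ; ⊤' = ⊥'
  ; ⊓-idem-l = ⊔-idem-l ; ⊔-idem-l = ⊓-idem-l ; ⊓-comm = ⊔-comm ; ⊔-comm = ⊓-comm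
  ; ⊓-assoc = ⊔-assoc ; ⊔-assoc = ⊓-assoc
  ; ⊓-absorb-⊔ = ⊔-absorb-⊓ ; ⊔-absorb-⊓ = ⊓-absorb-⊔
  ; ⊓-absorb-∨ = ⊔-absorb-∧ ; ⊔-absorb-∧ = ⊓-absorb-∨
  ; ⊓-distrib-∨ = ⊔-distrib-∧ ; ⊔-distrib-∧ = ⊓-distrib-∨
  ; ¬¬-⊓ = ⌟⌟-⊔ ; ⌟⌟-⊔ = ¬¬-⊓ ; ¬-⊓-idem = ⌟-⊔-idem ; ⌟-⊔-idem = ¬-⊓-idem
  ; ⊓-¬ = ⊔-⌟ ; ⊔-⌟ = ⊓-¬ ; ¬⊥ = ⌟⊤ ; ⌟⊤ = ¬⊥ ; ¬⊤ = ⌟⊥ ; ⌟⊥ = ¬⊤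
  ; mixed = λ x → sym (mixed x)
  }
  where open DBA A

isCongruence-dual : (A : DBA) {θ : Rel (DBA.D A) 0ℓ} → IsCongruence (dual A) θ → IsCongruence A θ
isCongruence-dual A c = record
  { isEquivalence = isEquivalence ; ⊓-cong = ⊔-cong ; ⊔-cong = ⊓-cong
  ; ¬-cong = ⌟-cong ; ⌟-cong = ¬-cong }
  where open IsCongruence c

simple-dual : (A : DBA) → Simple A → Simple (dual A)
simple-dual A simple θ c = simple θ (isCongruence-dual A c)

module BooleanAlgebraLemmas (B : BooleanAlgebra 0ℓ 0ℓ) where
  open BooleanAlgebra B renaming (¬_ to ~_)
  open BooleanAlgebraProperties B
  open SetoidReasoning setoid

  ∧-¬-∧ : ∀ a x → a ∧ ~ (a ∧ x) ≈ a ∧ ~ x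
  ∧-¬-∧ a x = begin
    a ∧ ~ (a ∧ x)         ≈⟨ ∧-congˡ (deMorgan₁ a x) ⟩
    a ∧ (~ a ∨ ~ x)       ≈⟨ ∧-distribˡ-∨ a (~ a) (~ x) ⟩
    (a ∧ ~ a) ∨ (a ∧ ~ x) ≈⟨ ∨-congʳ (∧-complementʳ a) ⟩
    ⊥ ∨ (a ∧ ~ x)         ≈⟨ ∨-identityˡ _ ⟩
    a ∧ ~ x               ∎

module Laws (A : DBA) where
  open DBA A
  open ≡-Reasoning

  ⊓-idem-r : ∀ x y → x ⊓ (y ⊓ y) ≡ x ⊓ y
  ⊓-idem-r x y = trans (⊓-comm x (y ⊓ y)) (trans (⊓-idem-l y x) (⊓-comm y x))

  x⊓[x⊓y]≡x⊓y : ∀ x y → x ⊓ (x ⊓ y) ≡ x ⊓ y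
  x⊓[x⊓y]≡x⊓y x y = trans (⊓-assoc x x y) (⊓-idem-l x y)

  ⊓-D⊓ : ∀ x y → D⊓ A (x ⊓ y)
  ⊓-D⊓ x y = begin
    (x ⊓ y) ⊓ (x ⊓ y) ≡⟨ ⊓-assoc (x ⊓ y) x y ⟩
    ((x ⊓ y) ⊓ x) ⊓ y ≡⟨ cong (_⊓ y) (⊓-comm (x ⊓ y) x) ⟩
    (x ⊓ (x ⊓ y)) ⊓ y ≡⟨ cong (_⊓ y) (x⊓[x⊓y]≡x⊓y x y) ⟩
    (x ⊓ y) ⊓ y       ≡⟨ sym (⊓-assoc x y y) ⟩
    x ⊓ (y ⊓ y)       ≡⟨ ⊓-idem-r x y ⟩
    x ⊓ y             ∎

  ⊓-via-squares : ∀ x y → x ⊓ y ≡ (y ⊓ y) ⊓ (x ⊓ x)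
  ⊓-via-squares x y = begin
    x ⊓ y             ≡⟨ sym (⊓-idem-l x y) ⟩
    (x ⊓ x) ⊓ y       ≡⟨ ⊓-comm (x ⊓ x) y ⟩
    y ⊓ (x ⊓ x)       ≡⟨ sym (⊓-idem-l y (x ⊓ x)) ⟩
    (y ⊓ y) ⊓ (x ⊓ x) ∎

  ⊓-cong-squares : ∀ {x x' y y'} → x ⊓ x ≡ x' ⊓ x' → y ⊓ y ≡ y' ⊓ y' → x ⊓ y ≡ x' ⊓ y'
  ⊓-cong-squares {x} {x'} {y} {y'} p q =
    trans (⊓-via-squares x y) (trans (cong₂ _⊓_ q p) (sym (⊓-via-squares x' y')))

  ¬-cong-squares : ∀ {x x'} → x ⊓ x ≡ x' ⊓ x' → ¬' x ≡ ¬' x'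
  ¬-cong-squares {x} {x'} p = trans (sym (¬-⊓-idem x)) (trans (cong ¬' p) (¬-⊓-idem x'))

  ⊓-⊤ : ∀ x → x ⊓ ⊤' ≡ x ⊓ x
  ⊓-⊤ x = trans (cong (x ⊓_) (sym (⊔-⌟ x))) (⊓-absorb-⊔ x (⌟ x))

  ⊓-⊥ : ∀ x → x ⊓ ⊥' ≡ ⊥'
  ⊓-⊥ x = begin
    x ⊓ ⊥'         ≡⟨ cong (x ⊓_) (sym (⊓-¬ x)) ⟩
    x ⊓ (x ⊓ ¬' x) ≡⟨ x⊓[x⊓y]≡x⊓y x (¬' x) ⟩
    x ⊓ ¬' x       ≡⟨ ⊓-¬ x ⟩
    ⊥'             ∎

  ¬¬x≡x⊓x : ∀ x → ¬' (¬' x) ≡ x ⊓ x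
  ¬¬x≡x⊓x x = trans (cong ¬' (sym (¬-⊓-idem x))) (¬¬-⊓ x x)

  ¬-D⊓ : ∀ x → D⊓ A (¬' x)
  ¬-D⊓ x = begin
    ¬' x ⊓ ¬' x           ≡⟨ sym (¬¬-⊓ (¬' x) (¬' x)) ⟩
    ¬' (¬' (¬' x ⊓ ¬' x)) ≡⟨ cong ¬' (¬-⊓-idem (¬' x)) ⟩
    ¬' (¬' (¬' x))        ≡⟨ cong ¬' (¬¬x≡x⊓x x) ⟩
    ¬' (x ⊓ x)            ≡⟨ ¬-⊓-idem x ⟩
    ¬' x                  ∎

  ⊥-∨ : ∀ y → ⊥' ∨ y ≡ ¬' (¬' y)
  ⊥-∨ y = begin
    ¬' (¬' ⊥' ⊓ ¬' y)     ≡⟨ cong (λ z → ¬' (z ⊓ ¬' y)) ¬⊥ ⟩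
    ¬' ((⊤' ⊓ ⊤') ⊓ ¬' y) ≡⟨ cong ¬' (⊓-idem-l ⊤' (¬' y)) ⟩
    ¬' (⊤' ⊓ ¬' y)        ≡⟨ cong ¬' (⊓-comm ⊤' (¬' y)) ⟩
    ¬' (¬' y ⊓ ⊤')        ≡⟨ cong ¬' (⊓-⊤ (¬' y)) ⟩
    ¬' (¬' y ⊓ ¬' y)      ≡⟨ ¬-⊓-idem (¬' y) ⟩
    ¬' (¬' y)             ∎

  ⊓-¬-⊓ : ∀ a x → a ⊓ ¬' (a ⊓ x) ≡ a ⊓ ¬' x
  ⊓-¬-⊓ a x = begin
    a ⊓ ¬' (a ⊓ x)          ≡⟨ cong (λ z → a ⊓ ¬' z) (sym ¬¬a⊓¬¬x≡a⊓x) ⟩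
    a ⊓ (¬' a ∨ ¬' x)       ≡⟨ ⊓-distrib-∨ a (¬' a) (¬' x) ⟩
    (a ⊓ ¬' a) ∨ (a ⊓ ¬' x) ≡⟨ cong (_∨ (a ⊓ ¬' x)) (⊓-¬ a) ⟩
    ⊥' ∨ (a ⊓ ¬' x)         ≡⟨ ⊥-∨ (a ⊓ ¬' x) ⟩
    ¬' (¬' (a ⊓ ¬' x))      ≡⟨ ¬¬-⊓ a (¬' x) ⟩
    a ⊓ ¬' x                ∎
    where
    ¬¬a⊓¬¬x≡a⊓x : ¬' (¬' a) ⊓ ¬' (¬' x) ≡ a ⊓ x
    ¬¬a⊓¬¬x≡a⊓x = begin
      ¬' (¬' a) ⊓ ¬' (¬' x) ≡⟨ cong₂ _⊓_ (¬¬x≡x⊓x a) (¬¬x≡x⊓x x) ⟩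
      (a ⊓ a) ⊓ (x ⊓ x)     ≡⟨ ⊓-idem-l a (x ⊓ x) ⟩
      a ⊓ (x ⊓ x)           ≡⟨ ⊓-idem-r a x ⟩
      a ⊓ x                 ∎

  ⊓-square-D⊔ : ∀ x → D⊔ A x → D⊔ A (x ⊓ x)
  ⊓-square-D⊔ x x∈D⊔ = trans (mixed x) (cong (λ z → z ⊓ z) x∈D⊔)

module Congruences (A : DBA) where
  open DBA A
  open Laws A
  private module Dual = Laws (dual A)

  SameSquares : Rel D 0ℓ
  SameSquares x y = (x ⊓ x ≡ y ⊓ y) × (x ⊔ x ≡ y ⊔ y)

  sameSquares-isCongruence : IsCongruence A SameSquares
  sameSquares-isCongruence = record
    { isEquivalence = record
        { refl = refl , refl
        ; sym = λ (p , q) → sym p , sym q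
        ; trans = λ (p , q) (p' , q') → trans p p' , trans q q' }
    ; ⊓-cong = λ (p , _) (q , _) → ≡⇒sameSquares (⊓-cong-squares p q)
    ; ⊔-cong = λ (_ , p) (_ , q) → ≡⇒sameSquares (Dual.⊓-cong-squares p q)
    ; ¬-cong = λ (p , _) → ≡⇒sameSquares (¬-cong-squares p)
    ; ⌟-cong = λ (_ , p) → ≡⇒sameSquares (Dual.¬-cong-squares p)
    }
    where
    ≡⇒sameSquares : ∀ {u v} → u ≡ v → SameSquares u v
    ≡⇒sameSquares refl = refl , refl

  -- When all elements have the same squares, every operation is constant.
  allSameSquares⇒isCongruence : (∀ x y → SameSquares x y) →
    ∀ {θ} → IsEquivalence θ → IsCongruence A θ
  allSameSquares⇒isCongruence same eq = record
    { isEquivalence = eq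
    ; ⊓-cong = λ {x} {x'} {y} {y'} _ _ → reflexive (⊓-cong-squares (sq x x') (sq y y'))
    ; ⊔-cong = λ {x} {x'} {y} {y'} _ _ → reflexive (Dual.⊓-cong-squares (sq⊔ x x') (sq⊔ y y'))
    ; ¬-cong = λ {x} {x'} _ → reflexive (¬-cong-squares (sq x x'))
    ; ⌟-cong = λ {x} {x'} _ → reflexive (Dual.¬-cong-squares (sq⊔ x x'))
    }
    where
    open IsEquivalence eq using (reflexive)
    sq : ∀ x y → x ⊓ x ≡ y ⊓ y
    sq x y = proj₁ (same x y)
    sq⊔ : ∀ x y → x ⊔ x ≡ y ⊔ y
    sq⊔ x y = proj₂ (same x y)

  θ : D → Rel D 0ℓ
  θ a x y = a ⊓ x ≡ a ⊓ y

  θ-isCongruence : ∀ a →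
    (∀ {x x' y y'} → θ a x x' → θ a y y' → θ a (x ⊔ y) (x' ⊔ y')) →
    (∀ {x x'} → θ a x x' → θ a (⌟ x) (⌟ x')) →
    IsCongruence A (θ a)
  θ-isCongruence a ⊔-cong ⌟-cong = record
    { isEquivalence = record { refl = refl ; sym = sym ; trans = trans }
    ; ⊓-cong = ⊓-cong ; ⊔-cong = ⊔-cong ; ¬-cong = ¬-cong ; ⌟-cong = ⌟-cong }
    where
    open ≡-Reasoning
    ⊓-cong : ∀ {x x' y y'} → θ a x x' → θ a y y' → θ a (x ⊓ y) (x' ⊓ y')
    ⊓-cong {x} {x'} {y} {y'} p q = begin
      a ⊓ (x ⊓ y)   ≡⟨ ⊓-assoc a x y ⟩
      (a ⊓ x) ⊓ y   ≡⟨ cong (_⊓ y) (trans p (⊓-comm a x')) ⟩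
      (x' ⊓ a) ⊓ y  ≡⟨ sym (⊓-assoc x' a y) ⟩
      x' ⊓ (a ⊓ y)  ≡⟨ cong (x' ⊓_) q ⟩
      x' ⊓ (a ⊓ y') ≡⟨ ⊓-assoc x' a y' ⟩
      (x' ⊓ a) ⊓ y' ≡⟨ cong (_⊓ y') (⊓-comm x' a) ⟩
      (a ⊓ x') ⊓ y' ≡⟨ sym (⊓-assoc a x' y') ⟩
      a ⊓ (x' ⊓ y') ∎
    ¬-cong : ∀ {x x'} → θ a x x' → θ a (¬' x) (¬' x')
    ¬-cong {x} {x'} p = trans (sym (⊓-¬-⊓ a x)) (trans (cong (λ z → a ⊓ ¬' z) p) (⊓-¬-⊓ a x'))

  -- Values of ⊔ and ⌟ lie in D⊔, so they are all θ_a-related.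
  θ-isCongruence-constantOnD⊔ : ∀ a → (∀ u v → D⊔ A u → D⊔ A v → a ⊓ u ≡ a ⊓ v) →
    IsCongruence A (θ a)
  θ-isCongruence-constantOnD⊔ a const = θ-isCongruence a
    (λ {x} {x'} {y} {y'} _ _ → const (x ⊔ y) (x' ⊔ y') (Dual.⊓-D⊓ x y) (Dual.⊓-D⊓ x' y'))
    (λ {x} {x'} _ → const (⌟ x) (⌟ x') (Dual.¬-D⊓ x) (Dual.¬-D⊓ x'))

module Simplicity (em : ExcludedMiddle 0ℓ) (A : DBA) where
  open DBA A
  open Laws A
  open Congruences A

  atMostTwo⇒simple : AtMostTwo A → Simple A
  atMostTwo⇒simple (a , b , a∨b) θ′ c with em {θ′ a b}
  ... | yes θab = inj₂ λ x y → related (a∨b x) (a∨b y)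
    where
    open IsEquivalence (IsCongruence.isEquivalence c) using () renaming (refl to θ-refl; sym to θ-sym)
    related : ∀ {x y} → x ≡ a ⊎ x ≡ b → y ≡ a ⊎ y ≡ b → θ′ x y
    related (inj₁ refl) (inj₁ refl) = θ-refl
    related (inj₁ refl) (inj₂ refl) = θab
    related (inj₂ refl) (inj₁ refl) = θ-sym θab
    related (inj₂ refl) (inj₂ refl) = θ-refl
  ... | no ¬θab = inj₁ λ x y → equal (a∨b x) (a∨b y)
    where
    open IsEquivalence (IsCongruence.isEquivalence c) using () renaming (sym to θ-sym)
    equal : ∀ {x y} → x ≡ a ⊎ x ≡ b → y ≡ a ⊎ y ≡ b → θ′ x y → x ≡ y
    equal (inj₁ refl) (inj₁ refl) _ = refl
    equal (inj₁ refl) (inj₂ refl) t = ⊥-elim (¬θab t)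
    equal (inj₂ refl) (inj₁ refl) t = ⊥-elim (¬θab (θ-sym t))
    equal (inj₂ refl) (inj₂ refl) _ = refl

  ⊥-apart : Rel D 0ℓ
  ⊥-apart x y = x ≡ y ⊎ ((¬ x ≡ ⊥') × (¬ y ≡ ⊥'))

  ⊥-apart-isEquivalence : IsEquivalence ⊥-apart
  ⊥-apart-isEquivalence = record { refl = inj₁ refl ; sym = ⊥-apart-sym ; trans = ⊥-apart-trans }
    where
    ⊥-apart-sym : ∀ {x y} → ⊥-apart x y → ⊥-apart y x
    ⊥-apart-sym (inj₁ p) = inj₁ (sym p)
    ⊥-apart-sym (inj₂ (p , q)) = inj₂ (q , p)
    ⊥-apart-trans : ∀ {x y z} → ⊥-apart x y → ⊥-apart y z → ⊥-apart x z
    ⊥-apart-trans (inj₁ refl) q = q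
    ⊥-apart-trans (inj₂ p) (inj₁ refl) = inj₂ p
    ⊥-apart-trans (inj₂ (p , _)) (inj₂ (_ , q)) = inj₂ (p , q)

  simple∧allEquivalencesCongruent⇒atMostTwo :
    (∀ {θ′} → IsEquivalence θ′ → IsCongruence A θ′) → Simple A → AtMostTwo A
  simple∧allEquivalencesCongruent⇒atMostTwo cong simple
    with simple ⊥-apart (cong ⊥-apart-isEquivalence)
  ... | inj₂ total = ⊥' , ⊥' , λ x → inj₁ (≡⊥ x (total x ⊥'))
    where
    ≡⊥ : ∀ x → ⊥-apart x ⊥' → x ≡ ⊥'
    ≡⊥ x (inj₁ p) = p
    ≡⊥ x (inj₂ (_ , ⊥≢⊥)) = ⊥-elim (⊥≢⊥ refl)
  ... | inj₁ diagonal with em {Σ D λ w → ¬ w ≡ ⊥'}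
  ...   | yes (w , w≢⊥) = ⊥' , w , λ x → ⊥-or-w x
    where
    ⊥-or-w : ∀ x → x ≡ ⊥' ⊎ x ≡ w
    ⊥-or-w x with em {x ≡ ⊥'}
    ... | yes x≡⊥ = inj₁ x≡⊥
    ... | no x≢⊥ = inj₂ (diagonal x w (inj₂ (x≢⊥ , w≢⊥)))
  ...   | no ∄w = ⊥' , ⊥' , λ x → inj₁ (≡⊥ x)
    where
    ≡⊥ : ∀ x → x ≡ ⊥'
    ≡⊥ x with em {x ≡ ⊥'}
    ... | yes x≡⊥ = x≡⊥
    ... | no x≢⊥ = ⊥-elim (∄w (x , x≢⊥))

  -- x ⊓ ⊤ θ_x ⊤ and x θ_x ⊥ always hold.
  simple∧idempotent⇒atMostTwo : (∀ x → D⊓ A x) → (∀ a → IsCongruence A (θ a)) →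
    Simple A → AtMostTwo A
  simple∧idempotent⇒atMostTwo idem θ-cong simple = ⊥' , ⊤' , λ x → ⊥-or-⊤ x (simple (θ x) (θ-cong x))
    where
    ⊥-or-⊤ : ∀ x → IsDiagonal A (θ x) ⊎ IsAll A (θ x) → x ≡ ⊥' ⊎ x ≡ ⊤'
    ⊥-or-⊤ x (inj₁ diagonal) =
      inj₂ (trans (sym (idem x)) (trans (sym (⊓-⊤ x)) (sym (diagonal ⊤' (x ⊓ ⊤') (sym (x⊓[x⊓y]≡x⊓y x ⊤'))))))
    ⊥-or-⊤ x (inj₂ total) = inj₁ (trans (sym (idem x)) (trans (total x ⊥') (⊓-⊥ x)))

  simple⇒atMostTwo : (∀ u → D⊔ A u → D⊓ A u) →
    ((∀ x → D⊓ A x) → ∀ a → IsCongruence A (θ a)) → Simple A → AtMostTwo A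
  simple⇒atMostTwo D⊔⊆D⊓ θ-cong simple with simple SameSquares sameSquares-isCongruence
  ... | inj₂ total = simple∧allEquivalencesCongruent⇒atMostTwo (allSameSquares⇒isCongruence total) simple
  ... | inj₁ diagonal = simple∧idempotent⇒atMostTwo idem (θ-cong idem) simple
    where
    open Laws (dual A) using () renaming (⊓-D⊓ to ⊔-D⊔)
    idem : ∀ x → D⊓ A x
    idem x = diagonal (x ⊓ x) x
      (⊓-D⊓ x x , trans (mixed x) (D⊔⊆D⊓ (x ⊔ x) (⊔-D⊔ x x)))

module TypeLemmas (A : DBA) where
  open DBA A
  open Laws A
  open Congruences A
  module Dual = Laws (dual A)

  typeI⇒D⊔⊆D⊓ : TypeI A → ∀ u → D⊔ A u → D⊓ A u
  typeI⇒D⊔⊆D⊓ (⊤∈D⊔ , D⊔≡⊤) u u∈D⊔ with D⊔≡⊤ u u∈D⊔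
  ... | refl = D⊔≡⊤ (⊤' ⊓ ⊤') (⊓-square-D⊔ ⊤' ⊤∈D⊔)

  typeI⇒θ-isCongruence : TypeI A → ∀ a → IsCongruence A (θ a)
  typeI⇒θ-isCongruence (_ , D⊔≡⊤) a = θ-isCongruence-constantOnD⊔ a
    λ u v u∈D⊔ v∈D⊔ → cong (a ⊓_) (trans (D⊔≡⊤ u u∈D⊔) (sym (D⊔≡⊤ v v∈D⊔)))

  typeV⇒Dp⊆D⊓ : TypeV A → ∀ x → Dp A x → D⊓ A x
  typeV⇒Dp⊆D⊓ tv x x∈Dp =
    trans (sym (⊓-absorb-⊔ x x)) (IsBooleanAlgebra.∧-absorbs-∨ boolean-¬ (x , x∈Dp) (x , x∈Dp))
    where open TypeV tv

  typeV∧idempotent⇒θ-isCongruence : TypeV A → (∀ x → D⊓ A x) → ∀ a → IsCongruence A (θ a)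
  typeV∧idempotent⇒θ-isCongruence tv idem a = θ-isCongruence a
    (λ {x} {x'} {y} {y'} p q → trans (⊓-distrib-⊔ a x y) (trans (cong₂ _⊔_ p q) (sym (⊓-distrib-⊔ a x' y'))))
    (λ {x} {x'} p → trans (sym (⊓-⌟-⊓ a x)) (trans (cong (λ z → a ⊓ ⌟ z) p) (⊓-⌟-⊓ a x')))
    where
    open TypeV tv
    ↑ : D → Dp-Carrier A
    ↑ x = x , inj₁ (idem x)
    ⊓-distrib-⊔ : ∀ a x y → a ⊓ (x ⊔ y) ≡ (a ⊓ x) ⊔ (a ⊓ y)
    ⊓-distrib-⊔ a x y = IsBooleanAlgebra.∧-distribˡ-∨ boolean-¬ (↑ a) (↑ x) (↑ y)
    ⊓-⌟-⊓ : ∀ a x → a ⊓ ⌟ (a ⊓ x) ≡ a ⊓ ⌟ x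
    ⊓-⌟-⊓ a x = BooleanAlgebraLemmas.∧-¬-∧
      (record { isBooleanAlgebra = boolean-⌟ }) (↑ a) (↑ x)

  ⊥≡⊤⇒typeII : ⊥' ≡ ⊤' → TypeII A
  ⊥≡⊤⇒typeII ⊥≡⊤ = ⊓-⊥ ⊥' , λ x x∈D⊓ →
    trans (sym x∈D⊓) (trans (sym (⊓-⊤ x)) (trans (cong (x ⊓_) (sym ⊥≡⊤)) (⊓-⊥ x)))

  ⊥⊔⊥∈D⊓ : D⊓ A (⊥' ⊔ ⊥')
  ⊥⊔⊥∈D⊓ = trans (sym (mixed ⊥')) (cong₂ _⊔_ (⊓-⊥ ⊥') (⊓-⊥ ⊥'))

  ⊥⊔⊥-⊓-D⊔ : ∀ u → D⊔ A u → (⊥' ⊔ ⊥') ⊓ u ≡ ⊥' ⊔ ⊥'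
  ⊥⊔⊥-⊓-D⊔ u u∈D⊔ = begin
    (⊥' ⊔ ⊥') ⊓ u                 ≡⟨ cong ((⊥' ⊔ ⊥') ⊓_) (sym b⊔u≡u) ⟩
    (⊥' ⊔ ⊥') ⊓ ((⊥' ⊔ ⊥') ⊔ u)   ≡⟨ ⊓-absorb-⊔ (⊥' ⊔ ⊥') u ⟩
    (⊥' ⊔ ⊥') ⊓ (⊥' ⊔ ⊥')         ≡⟨ ⊥⊔⊥∈D⊓ ⟩
    ⊥' ⊔ ⊥'                       ∎
    where
    open ≡-Reasoning
    b⊔u≡u : (⊥' ⊔ ⊥') ⊔ u ≡ u
    b⊔u≡u = trans (⊔-idem-l ⊥' u) (trans (⊔-comm ⊥' u) (trans (Dual.⊓-⊤ u) u∈D⊔))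

  -- θ_b for b = ⊥ ⊔ ⊥ is a congruence; it cannot be total since b ≠ ⊥ = b ⊓ ⊥,
  -- and being diagonal it makes b the only element of D⊔.
  simple∧⊥⊔⊥≢⊥⇒typeI : ¬ (⊥' ⊔ ⊥' ≡ ⊥') → Simple A → TypeI A
  simple∧⊥⊔⊥≢⊥⇒typeI b≢⊥ simple with simple (θ b) (θ-isCongruence-constantOnD⊔ b b⊓-const)
    where
    b : D
    b = ⊥' ⊔ ⊥'
    b⊓-const : ∀ u v → D⊔ A u → D⊔ A v → b ⊓ u ≡ b ⊓ v
    b⊓-const u v u∈D⊔ v∈D⊔ = trans (⊥⊔⊥-⊓-D⊔ u u∈D⊔) (sym (⊥⊔⊥-⊓-D⊔ v v∈D⊔))
  ... | inj₂ total =
    ⊥-elim (b≢⊥ (trans (sym ⊥⊔⊥∈D⊓) (trans (total (⊥' ⊔ ⊥') ⊥') (⊓-⊥ (⊥' ⊔ ⊥')))))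
  ... | inj₁ diagonal = Dual.⊓-⊥ ⊤' , λ u u∈D⊔ → trans (≡b u u∈D⊔) (sym (≡b ⊤' (Dual.⊓-⊥ ⊤')))
    where
    ≡b : ∀ u → D⊔ A u → u ≡ ⊥' ⊔ ⊥'
    ≡b u u∈D⊔ = trans (sym (diagonal _ u (x⊓[x⊓y]≡x⊓y (⊥' ⊔ ⊥') u))) (⊥⊔⊥-⊓-D⊔ u u∈D⊔)

typeI-simple⇒atMostTwo : ExcludedMiddle 0ℓ → (A : DBA) → TypeI A → Simple A → AtMostTwo A
typeI-simple⇒atMostTwo em A t = simple⇒atMostTwo (typeI⇒D⊔⊆D⊓ t) (λ _ → typeI⇒θ-isCongruence t)
  where
  open Simplicity em A
  open TypeLemmas A

typeII-simple⇒atMostTwo : ExcludedMiddle 0ℓ → (A : DBA) → TypeII A → Simple A → AtMostTwo A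
typeII-simple⇒atMostTwo em A t simple = typeI-simple⇒atMostTwo em (dual A) t (simple-dual A simple)

typeIV-simple⇒atMostTwo : ExcludedMiddle 0ℓ → (A : DBA) → TypeIV A → Simple A → AtMostTwo A
typeIV-simple⇒atMostTwo em A (inj₁ ⊥≡⊤) =
  typeII-simple⇒atMostTwo em A (TypeLemmas.⊥≡⊤⇒typeII A ⊥≡⊤)
typeIV-simple⇒atMostTwo em A (inj₂ (inj₁ b≢⊥)) simple =
  typeI-simple⇒atMostTwo em A (TypeLemmas.simple∧⊥⊔⊥≢⊥⇒typeI A b≢⊥ simple) simple
typeIV-simple⇒atMostTwo em A (inj₂ (inj₂ t≢⊤)) simple =
  typeII-simple⇒atMostTwo em A (TypeLemmas.simple∧⊥⊔⊥≢⊥⇒typeI (dual A) t≢⊤ (simple-dual A simple)) simple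

typeV-simple⇒atMostTwo : ExcludedMiddle 0ℓ → (A : DBA) → TypeV A → Simple A → AtMostTwo A
typeV-simple⇒atMostTwo em A t =
  simple⇒atMostTwo (λ u u∈D⊔ → typeV⇒Dp⊆D⊓ t u (inj₂ u∈D⊔)) (typeV∧idempotent⇒θ-isCongruence t)
  where
  open Simplicity em A
  open TypeLemmas A

corollary3p19 : ExcludedMiddle 0ℓ → (A : DBA) → OfTypeI-II-IV-V A →
    (Simple A ⇔ AtMostTwo A)
corollary3p19 em A type = mk⇔ (simple⇒atMostTwo type) (Simplicity.atMostTwo⇒simple em A)
  where
  simple⇒atMostTwo : OfTypeI-II-IV-V A → Simple A → AtMostTwo A
  simple⇒atMostTwo (inj₁ t) = typeI-simple⇒atMostTwo em A t
  simple⇒atMostTwo (inj₂ (inj₁ t)) = typeII-simple⇒atMostTwo em A t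
  simple⇒atMostTwo (inj₂ (inj₂ (inj₁ t))) = typeIV-simple⇒atMostTwo em A t
  simple⇒atMostTwo (inj₂ (inj₂ (inj₂ t))) = typeV-simple⇒atMostTwo em A t
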